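{- Let $p$ be a prime and $k$ an integer in $[1,p-1]$. For any integers $1\le j\le k$ and $-j\le i\le j$, there exists a circuit $\mathbf{L}$ consisting only of unit-weight edges with $\mathrm{nnz}(\mathbf{L})=O(k)$ whose resistance is congruent modulo $p$ to some integer $w\in[\frac{pi}{j},\frac{pi}{j}+1]$.
   Context: A unit-weight circuit is the Laplacian $\mathbf{L}$ over $\mathbb{Z}_p$ of an undirected unweighted graph on vertices $1,\dots,n$ ($\mathbf{L}_{a,a}=\deg(a)$, $\mathbf{L}_{a,b}=-1$ for edges, $0$ otherwise, mod $p$) such that $\mathrm{SC}(\mathbf{L},\{1,2\})=r(\mathbf{e}_1-\mathbf{e}_2)(\mathbf{e}_1-\mathbf{e}_2)^\top$ for some $r\in\mathbb{Z}_p\setminus\{0\}$, where $\mathrm{SC}(\mathbf{A},T)=\mathbf{A}_{T,T}-\mathbf{A}_{T,S}\mathbf{A}_{S,S}^{ -1}\mathbf{A}_{S,T}$ with $S$ the complement of $T$ (requiring $\mathbf{A}_{S,S}$ invertible). Its resistance is $r^{ -1}$; the resistance is congruent to an integer $w$ if $r^{ -1}\equiv w\pmod p$. -}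

module Defs where

open import Data.Bool using (Bool; true; false; if_then_else_)
open import Data.Nat as ℕ using (ℕ; zero; suc)
open import Data.Nat.Divisibility as ℕDiv using (_∣?_)
open import Data.Integer using (ℤ; +_; -_; _+_; _-_; _*_; ∣_∣)
open import Data.Integer.Divisibility using (_∣_)
open import Data.Fin using (Fin; zero; suc; _≟_)
open import Data.Product using (Σ; _×_; ∃)
open import Relation.Nullary using (¬_; yes; no)
open import Relation.Nullary.Decidable using (does)
open import Relation.Binary.PropositionalEquality using (_≡_)

-- Matrices over ℤ (entries are read modulo p).
Matrix : ℕ → ℕ → Set
Matrix m n = Fin m → Fin n → ℤ

sumℤ : ∀ {n} → (Fin n → ℤ) → ℤ
sumℤ {zero}  f = + 0
sumℤ {suc n} f = f zero + sumℤ (λ i → f (suc i))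

sumℕ : ∀ {n} → (Fin n → ℕ) → ℕ
sumℕ {zero}  f = 0
sumℕ {suc n} f = f zero ℕ.+ sumℕ (λ i → f (suc i))

_⊗_ : ∀ {l m n} → Matrix l m → Matrix m n → Matrix l n
(A ⊗ B) a c = sumℤ (λ b → A a b * B b c)

identity : ∀ {n} → Matrix n n
identity a b = if does (a ≟ b) then + 1 else + 0

_≡_[mod_] : ℤ → ℤ → ℕ → Set
x ≡ y [mod p ] = (+ p) ∣ (x - y)

_≋_[modM_] : ∀ {m n} → Matrix m n → Matrix m n → ℕ → Set
A ≋ B [modM p ] = ∀ a b → A a b ≡ B a b [mod p ]

record Graph (N : ℕ) : Set where
  field
    adj    : Fin N → Fin N → Bool
    sym    : ∀ a b → adj a b ≡ adj b a
    irrefl : ∀ a → adj a a ≡ false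
open Graph public

degree : ∀ {N} → Graph N → Fin N → ℕ
degree G a = sumℕ (λ b → if adj G a b then 1 else 0)

laplacian : ∀ {N} → Graph N → Matrix N N
laplacian G a b with a ≟ b
... | yes _ = + degree G a
... | no  _ = if adj G a b then - (+ 1) else + 0

nnz : ∀ {m n} → ℕ → Matrix m n → ℕ
nnz p A = sumℕ (λ a → sumℕ (λ b → if does (p ∣? ∣ A a b ∣) then 0 else 1))

-- Vertices are Fin (2 + m); T = {zero , suc zero} are the terminals 1,2,
-- S = the remaining m vertices (suc (suc s)).
blockTT : ∀ {m} → Matrix (2 ℕ.+ m) (2 ℕ.+ m) → Matrix 2 2
blockTT A s t = A (s Data.Fin.↑ˡ _) (t Data.Fin.↑ˡ _)

blockTS : ∀ {m} → Matrix (2 ℕ.+ m) (2 ℕ.+ m) → Matrix 2 m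
blockTS A s b = A (s Data.Fin.↑ˡ _) (suc (suc b))

blockST : ∀ {m} → Matrix (2 ℕ.+ m) (2 ℕ.+ m) → Matrix m 2
blockST A a t = A (suc (suc a)) (t Data.Fin.↑ˡ _)

blockSS : ∀ {m} → Matrix (2 ℕ.+ m) (2 ℕ.+ m) → Matrix m m
blockSS A a b = A (suc (suc a)) (suc (suc b))

-- (e₁ - e₂)(e₁ - e₂)ᵀ
e12 : Matrix 2 2
e12 a b = if does (a ≟ b) then + 1 else - (+ 1)

scale : ∀ {m n} → ℤ → Matrix m n → Matrix m n
scale r A a b = r * A a b

-- SC(A, T) over ℤ_p equals B, with X a (ℤ_p-)inverse of A_SS.
-- Since the inverse of A_SS is unique mod p, this is exactly
-- "A_SS invertible over ℤ_p and A_TT - A_TS A_SS⁻¹ A_ST = B in ℤ_p".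
SchurIs : ∀ {m} → ℕ → Matrix (2 ℕ.+ m) (2 ℕ.+ m) → Matrix 2 2 → Set
SchurIs {m} p A B =
  Σ (Matrix m m) λ X →
    ((blockSS A ⊗ X) ≋ identity [modM p ]) ×
    ((X ⊗ blockSS A) ≋ identity [modM p ]) ×
    ((λ s t → blockTT A s t - (blockTS A ⊗ (X ⊗ blockST A)) s t) ≋ B [modM p ])

IsUnitCircuit : ∀ {m} → ℕ → Graph (2 ℕ.+ m) → ℤ → Set
IsUnitCircuit p G r = ¬ (r ≡ + 0 [mod p ]) × SchurIs p (laplacian G) (scale r e12)

-- Resistance r⁻¹ is congruent to w mod p, i.e. r * w ≡ 1 (mod p).
ResistanceCongruent : ℕ → ℤ → ℤ → Set
ResistanceCongruent p r w = (r * w) ≡ + 1 [mod p ]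

{-# OPTIONS --safe #-}
module Submission where

-- A circuit whose Schur complement onto the terminals is r (e₁ - e₂)(e₁ - e₂)ᵀ has
-- conductance r.  Attaching a vertex to some terminals adds the Laplacian of that star to
-- the Schur complement, and eliminating one of the three resulting boundary vertices is a
-- single pivot (the quotient formula for Schur complements).  Hanging a new terminal off
-- an old one thus turns r into r / (1 + r), and a path of length two between the
-- terminals adds ½.  Euclid's subtractive algorithm on j / t, run with these two steps,
-- builds a circuit of conductance j / t with O(j + t) edges.  Writing p i = j w - t with
-- 1 ≤ t ≤ j, i.e. w is p i / j rounded up, its resistance t / j is congruent to w.

open import Defs hiding (sym)
open import Data.Nat using (ℕ; _∸_; suc)
open import Data.Nat.Primality using (Prime)
open import Data.Integer using (ℤ; +_; -_; _+_; _*_; _≤_)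
open import Data.Product using (Σ; _×_; ∃; ∃-syntax)
open import Data.Bool using (Bool; true; false; if_then_else_)
import Data.Nat as ℕ
open import Data.Nat using (zero; z≤n; s≤s; NonZero)
import Data.Nat.Properties as ℕ
open import Algebra.Properties.CommutativeSemigroup ℕ.+-commutativeSemigroup
  using (x∙yz≈y∙xz; interchange)
open import Data.Nat.Coprimality using (prime⇒coprime; coprime-Bézout)
open import Data.Nat.Divisibility using (_∣?_; _∣0)
import Data.Nat.Divisibility as ℕ
import Data.Nat.GCD as GCD
open import Data.Nat.Primality using (prime⇒nonZero)
import Data.Nat.Tactic.RingSolver as ℕ-Solver
open import Data.Integer using (_-_; ∣_∣; +≤+)
import Data.Integer.DivMod as ℤ
import Data.Integer.Divisibility.Signed as Signed
import Data.Integer.Properties as ℤ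
open import Data.Integer.Tactic.RingSolver using (solve-∀)
open import Data.Fin using (Fin; zero; suc; _≟_; _↑ˡ_; _↑ʳ_; punchIn; punchOut)
open import Data.Fin.Patterns using (0F; 1F; 2F)
import Data.Fin.Properties as Fin
open import Data.Product using (_,_; proj₁; proj₂)
open import Data.Vec.Functional using (insertAt)
open import Data.Vec.Functional.Properties using (insertAt-lookup; insertAt-punchIn)
open import Function using (_∘_)
open import Relation.Binary using (tri<; tri≈; tri>)
open import Relation.Binary.Bundles using (Setoid)
open import Relation.Binary.PropositionalEquality
  using (_≡_; _≢_; refl; sym; trans; cong; cong₂; subst; subst₂; module ≡-Reasoning)
import Relation.Binary.Reasoning.Setoid as SetoidReasoning
open import Relation.Nullary using (¬_; Dec; yes; no; contradiction)
open import Relation.Nullary.Decidable using (does; dec-true; dec-false)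

Vector : ℕ → Set
Vector n = Fin n → ℤ

sumℤ-cong : ∀ {n} {f g : Vector n} → (∀ i → f i ≡ g i) → sumℤ f ≡ sumℤ g
sumℤ-cong {zero}  f≗g = refl
sumℤ-cong {suc n} f≗g = cong₂ _+_ (f≗g zero) (sumℤ-cong (λ i → f≗g (suc i)))

sumℤ-zero : ∀ n → sumℤ {n} (λ _ → + 0) ≡ + 0
sumℤ-zero zero    = refl
sumℤ-zero (suc n) = trans (ℤ.+-identityˡ _) (sumℤ-zero n)

sumℤ-distrib-+ : ∀ {n} (f g : Vector n) → sumℤ (λ i → f i + g i) ≡ sumℤ f + sumℤ g
sumℤ-distrib-+ {zero}  f g = refl
sumℤ-distrib-+ {suc n} f g =
  trans (cong (_+_ (f zero + g zero)) (sumℤ-distrib-+ (λ i → f (suc i)) (λ i → g (suc i))))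
  (algebra (f zero) (g zero) (sumℤ (λ i → f (suc i))) (sumℤ (λ i → g (suc i))))
  where
  algebra : ∀ a b c d → a + b + (c + d) ≡ a + c + (b + d)
  algebra = solve-∀

*-distribˡ-sumℤ : ∀ {n} k (f : Vector n) → k * sumℤ f ≡ sumℤ (λ i → k * f i)
*-distribˡ-sumℤ {zero}  k f = ℤ.*-zeroʳ k
*-distribˡ-sumℤ {suc n} k f =
  trans (ℤ.*-distribˡ-+ k (f zero) _) (cong (_+_ (k * f zero)) (*-distribˡ-sumℤ k (λ i → f (suc i))))

*-distribʳ-sumℤ : ∀ {n} k (f : Vector n) → sumℤ f * k ≡ sumℤ (λ i → f i * k)
*-distribʳ-sumℤ k f =
  trans (ℤ.*-comm (sumℤ f) k) (trans (*-distribˡ-sumℤ k f) (sumℤ-cong (λ i → ℤ.*-comm k (f i))))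

sumℤ-comm : ∀ {m n} (F : Fin m → Fin n → ℤ) →
            sumℤ (λ i → sumℤ (λ j → F i j)) ≡ sumℤ (λ j → sumℤ (λ i → F i j))
sumℤ-comm {zero}  {n} F = sym (sumℤ-zero n)
sumℤ-comm {suc m} {n} F = trans (cong (_+_ (sumℤ (F zero))) (sumℤ-comm (λ i → F (suc i))))
  (sym (sumℤ-distrib-+ (F zero) (λ j → sumℤ (λ i → F (suc i) j))))

infixl 7 _·_ _ᵥ*_
infixr 7 _*ᵥ_

_·_ : ∀ {n} → Vector n → Vector n → ℤ
u · v = sumℤ (λ c → u c * v c)

_*ᵥ_ : ∀ {m n} → Matrix m n → Vector n → Vector m
(A *ᵥ v) a = A a · v

_ᵥ*_ : ∀ {m n} → Vector m → Matrix m n → Vector n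
(v ᵥ* A) b = v · (λ c → A c b)

·-comm : ∀ {n} (u v : Vector n) → u · v ≡ v · u
·-comm u v = sumℤ-cong (λ c → ℤ.*-comm (u c) (v c))

·-scaleʳ : ∀ {n} k (u v : Vector n) → u · (λ c → k * v c) ≡ k * (u · v)
·-scaleʳ k u v = trans (sumℤ-cong (λ c → algebra (u c) k (v c))) (sym (*-distribˡ-sumℤ k (λ c → u c * v c)))
  where
  algebra : ∀ u k v → u * (k * v) ≡ k * (u * v)
  algebra = solve-∀

·-scaleˡ : ∀ {n} k (v u : Vector n) → (λ c → k * v c) · u ≡ k * (v · u)
·-scaleˡ k v u = trans (·-comm (λ c → k * v c) u) (trans (·-scaleʳ k u v) (cong (k *_) (·-comm u v)))

·-distribʳ-+ : ∀ {n} (u v v′ : Vector n) → u · (λ c → v c + v′ c) ≡ u · v + u · v′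
·-distribʳ-+ u v v′ = trans (sumℤ-cong (λ c → ℤ.*-distribˡ-+ (u c) (v c) (v′ c)))
  (sumℤ-distrib-+ (λ c → u c * v c) (λ c → u c * v′ c))

·-*ᵥ : ∀ {m n} (u : Vector m) (Y : Matrix m n) (v : Vector n) → u · (Y *ᵥ v) ≡ (u ᵥ* Y) · v
·-*ᵥ u Y v = begin
  sumℤ (λ b → u b * sumℤ (λ c → Y b c * v c))
    ≡⟨ sumℤ-cong (λ b → *-distribˡ-sumℤ (u b) (λ c → Y b c * v c)) ⟩
  sumℤ (λ b → sumℤ (λ c → u b * (Y b c * v c)))
    ≡⟨ sumℤ-comm (λ b c → u b * (Y b c * v c)) ⟩
  sumℤ (λ c → sumℤ (λ b → u b * (Y b c * v c)))
    ≡⟨ sumℤ-cong (λ c → sumℤ-cong (λ b → sym (ℤ.*-assoc (u b) (Y b c) (v c)))) ⟩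
  sumℤ (λ c → sumℤ (λ b → u b * Y b c * v c))
    ≡⟨ sumℤ-cong (λ c → sym (*-distribʳ-sumℤ (v c) (λ b → u b * Y b c))) ⟩
  sumℤ (λ c → (u ᵥ* Y) c * v c) ∎
  where open ≡-Reasoning

identity-*ᵥ : ∀ {n} (v : Vector n) a → (identity *ᵥ v) a ≡ v a
identity-*ᵥ {suc n} v zero =
  trans (cong (_+_ (+ 1 * v zero)) rest) (trans (ℤ.+-identityʳ _) (ℤ.*-identityˡ (v zero)))
  where
  rest : sumℤ (λ c → identity {suc n} zero (suc c) * v (suc c)) ≡ + 0
  rest = trans (sumℤ-cong (λ c → ℤ.*-zeroˡ (v (suc c)))) (sumℤ-zero n)
identity-*ᵥ {suc n} v (suc a) =
  trans (cong (_+ sumℤ (λ c → identity (suc a) (suc c) * v (suc c))) (ℤ.*-zeroˡ (v zero)))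
  (trans (ℤ.+-identityˡ _) (identity-*ᵥ (λ c → v (suc c)) a))

ᵥ*-identity : ∀ {n} (v : Vector n) b → (v ᵥ* identity) b ≡ v b
ᵥ*-identity v b = trans (sumℤ-cong (λ c → trans (ℤ.*-comm (v c) _) (cong (_* v c) (identity-sym c b))))
  (identity-*ᵥ v b)
  where
  identity-sym : ∀ {n} (c b : Fin n) → identity c b ≡ identity b c
  identity-sym zero zero = refl
  identity-sym zero (suc b) = refl
  identity-sym (suc c) zero = refl
  identity-sym (suc c) (suc b) = identity-sym c b

·-rankOneʳ : ∀ {m n} (u : Vector m) (Y : Matrix m n) k (z : Vector m) (w : Vector n) b →
             u · (λ c → Y c b + k * (z c * w b)) ≡ (u ᵥ* Y) b + k * (u · z) * w b
·-rankOneʳ u Y k z w b = begin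
  u · (λ c → Y c b + k * (z c * w b))
    ≡⟨ ·-distribʳ-+ u (λ c → Y c b) (λ c → k * (z c * w b)) ⟩
  (u ᵥ* Y) b + u · (λ c → k * (z c * w b))
    ≡⟨ cong (_+_ ((u ᵥ* Y) b))
         (trans (sumℤ-cong (λ c → algebra k (u c) (z c) (w b))) (·-scaleʳ (k * w b) u z)) ⟩
  (u ᵥ* Y) b + k * w b * (u · z)
    ≡⟨ cong (_+_ ((u ᵥ* Y) b)) (algebra′ k (w b) (u · z)) ⟩
  (u ᵥ* Y) b + k * (u · z) * w b ∎
  where
  open ≡-Reasoning
  algebra : ∀ k u z w → u * (k * (z * w)) ≡ u * ((k * w) * z)
  algebra = solve-∀
  algebra′ : ∀ k w d → k * w * d ≡ k * d * w
  algebra′ = solve-∀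

·-rankOneˡ : ∀ {m n} (Y : Matrix m n) k (z : Vector m) (w v : Vector n) a →
             (λ c → Y a c + k * (z a * w c)) · v ≡ (Y *ᵥ v) a + k * z a * (w · v)
·-rankOneˡ Y k z w v a = begin
  (λ c → Y a c + k * (z a * w c)) · v
    ≡⟨ ·-comm (λ c → Y a c + k * (z a * w c)) v ⟩
  v · (λ c → Y a c + k * (z a * w c))
    ≡⟨ ·-distribʳ-+ v (Y a) (λ c → k * (z a * w c)) ⟩
  v · Y a + v · (λ c → k * (z a * w c))
    ≡⟨ cong₂ _+_ (·-comm v (Y a))
         (trans (sumℤ-cong (λ c → algebra k (v c) (z a) (w c))) (·-scaleʳ (k * z a) v w)) ⟩
  (Y *ᵥ v) a + k * z a * (v · w)
    ≡⟨ cong (λ d → (Y *ᵥ v) a + k * z a * d) (·-comm v w) ⟩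
  (Y *ᵥ v) a + k * z a * (w · v) ∎
  where
  open ≡-Reasoning
  algebra : ∀ k v z w → v * (k * (z * w)) ≡ v * ((k * z) * w)
  algebra = solve-∀

·-zeroˡ : ∀ {n} {u : Vector n} (v : Vector n) → (∀ c → u c ≡ + 0) → u · v ≡ + 0
·-zeroˡ {n} {u} v u≗0 =
  trans (sumℤ-cong (λ c → trans (cong (_* v c) (u≗0 c)) (ℤ.*-zeroˡ (v c)))) (sumℤ-zero n)

·-*ᵥ-zeroʳ : ∀ {n} (u : Vector n) (Y : Matrix n n) {v : Vector n} → (∀ c → v c ≡ + 0) → u · (Y *ᵥ v) ≡ + 0
·-*ᵥ-zeroʳ u Y {v} v≗0 =
  trans (·-comm u (Y *ᵥ v)) (·-zeroˡ u (λ a → trans (·-comm (Y a) v) (·-zeroˡ (Y a) v≗0)))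

·-*ᵥ-cong : ∀ {n} {u u′ v v′ : Vector n} (Y : Matrix n n) →
            (∀ c → u c ≡ u′ c) → (∀ c → v c ≡ v′ c) →
            u · (Y *ᵥ v) ≡ u′ · (Y *ᵥ v′)
·-*ᵥ-cong Y u≗u′ v≗v′ =
  sumℤ-cong (λ c → cong₂ _*_ (u≗u′ c) (sumℤ-cong (λ d → cong (Y c d *_) (v≗v′ d))))

-- SchurIs is (definitionally) the case k = 2.
SchurOnto : ∀ k {m} → ℕ → Matrix (k ℕ.+ m) (k ℕ.+ m) → Matrix k k → Set
SchurOnto k {m} p A B =
  Σ (Matrix m m) λ X →
    ((interior ⊗ X) ≋ identity [modM p ]) ×
    ((X ⊗ interior) ≋ identity [modM p ]) ×
    ((λ s t → A (s ↑ˡ m) (t ↑ˡ m) - (boundaryRows ⊗ (X ⊗ boundaryCols)) s t) ≋ B [modM p ])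
  where
  interior : Matrix m m
  interior a b = A (k ↑ʳ a) (k ↑ʳ b)
  boundaryRows : Matrix k m
  boundaryRows s b = A (s ↑ˡ m) (k ↑ʳ b)
  boundaryCols : Matrix m k
  boundaryCols a t = A (k ↑ʳ a) (t ↑ˡ m)

module Congruence (p : ℕ) where

  -- A record, so that x and y can be inferred from a proof of x ≈ y.
  infix 4 _≈_
  record _≈_ (x y : ℤ) : Set where
    constructor mk≈
    field ≈⇒≡[mod] : x ≡ y [mod p ]
  open _≈_ public

  private
    toSigned : ∀ {x y} → x ≈ y → + p Signed.∣ (x - y)
    toSigned x≈y = Signed.∣ᵤ⇒∣ (≈⇒≡[mod] x≈y)

    fromSigned : ∀ {x y d} → d ≡ x - y → + p Signed.∣ d → x ≈ y
    fromSigned refl p∣d = mk≈ (Signed.∣⇒∣ᵤ p∣d)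

  ≈-reflexive : ∀ {x y} → x ≡ y → x ≈ y
  ≈-reflexive {x} refl = fromSigned (sym (ℤ.+-inverseʳ x)) (Signed.divides (+ 0) refl)

  ≈-refl : ∀ {x} → x ≈ x
  ≈-refl = ≈-reflexive refl

  ≈-sym : ∀ {x y} → x ≈ y → y ≈ x
  ≈-sym {x} {y} x≈y = fromSigned (algebra x y) (Signed.∣m⇒∣-m (toSigned x≈y))
    where
    algebra : ∀ x y → - (x - y) ≡ y - x
    algebra = solve-∀

  ≈-trans : ∀ {x y z} → x ≈ y → y ≈ z → x ≈ z
  ≈-trans {x} {y} {z} x≈y y≈z =
    fromSigned (algebra x y z) (Signed.∣m∣n⇒∣m+n (toSigned x≈y) (toSigned y≈z))
    where
    algebra : ∀ x y z → (x - y) + (y - z) ≡ x - z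
    algebra = solve-∀

  ≈-setoid : Setoid _ _
  ≈-setoid = record
    { Carrier = ℤ ; _≈_ = _≈_
    ; isEquivalence = record { refl = ≈-refl ; sym = ≈-sym ; trans = ≈-trans } }

  +-cong : ∀ {x y u v} → x ≈ y → u ≈ v → x + u ≈ y + v
  +-cong {x} {y} {u} {v} x≈y u≈v =
    fromSigned (algebra x y u v) (Signed.∣m∣n⇒∣m+n (toSigned x≈y) (toSigned u≈v))
    where
    algebra : ∀ x y u v → (x - y) + (u - v) ≡ (x + u) - (y + v)
    algebra = solve-∀

  -‿cong : ∀ {x y} → x ≈ y → - x ≈ - y
  -‿cong {x} {y} x≈y = fromSigned (algebra x y) (Signed.∣m⇒∣-m (toSigned x≈y))
    where
    algebra : ∀ x y → - (x - y) ≡ (- x) - (- y)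
    algebra = solve-∀

  *-cong : ∀ {x y u v} → x ≈ y → u ≈ v → x * u ≈ y * v
  *-cong {x} {y} {u} {v} x≈y u≈v = fromSigned (algebra x y u v)
    (Signed.∣m∣n⇒∣m+n (Signed.∣n⇒∣m*n x (toSigned u≈v)) (Signed.∣m⇒∣m*n v (toSigned x≈y)))
    where
    algebra : ∀ x y u v → x * (u - v) + (x - y) * v ≡ x * u - y * v
    algebra = solve-∀

  multiple≈0 : ∀ y → + p * y ≈ + 0
  multiple≈0 y = fromSigned (algebra (+ p) y) (Signed.divides y refl)
    where
    algebra : ∀ p y → y * p ≡ p * y - + 0
    algebra = solve-∀

  x+k[1-z]≈x : ∀ {z} x k → z ≈ + 1 → x + k * (+ 1 - z) ≈ x
  x+k[1-z]≈x x k z≈1 =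
    ≈-trans (+-cong (≈-refl {x}) (*-cong (≈-refl {k}) (+-cong (≈-refl {+ 1}) (-‿cong z≈1))))
            (≈-reflexive (algebra x k))
    where
    algebra : ∀ x k → x + k * (+ 1 - + 1) ≡ x
    algebra = solve-∀

  private
    bézout : ∀ {z w} a b c d → z ≡ w + - (+ 1 + + a * + b - + c * + d) → 1 ℕ.+ a ℕ.* b ≡ c ℕ.* d → z ≡ w
    bézout {z} {w} a b c d eq natEq = trans eq (trans (cong (λ D → w + - D) vanishes) (ℤ.+-identityʳ w))
      where
      vanishes : + 1 + + a * + b - + c * + d ≡ + 0
      vanishes = begin
        + 1 + + a * + b - + c * + d
          ≡⟨ cong₂ (λ u v → + 1 + u - v) (sym (ℤ.pos-* a b)) (sym (ℤ.pos-* c d)) ⟩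
        + (1 ℕ.+ a ℕ.* b) - + (c ℕ.* d) ≡⟨ cong (λ u → + u - + (c ℕ.* d)) natEq ⟩
        + (c ℕ.* d) - + (c ℕ.* d)
          ≡⟨ ℤ.+-inverseʳ (+ (c ℕ.* d)) ⟩
        + 0 ∎
        where open ≡-Reasoning

  inverse : Prime p → ∀ {n} → 0 ℕ.< n → n ℕ.< p → Σ ℤ λ v → + n * v ≈ + 1
  inverse p-prime {n} 0<n n<p
    with coprime-Bézout (prime⇒coprime p-prime {{ℕ.>-nonZero 0<n}} n<p)
  ... | GCD.Bézout.+- x y eq = - (+ y) , fromSigned (sym (bézout y n x p (algebra (+ n) (+ y) (+ x) (+ p)) eq))
          (Signed.divides (- (+ x)) refl)
    where
    algebra : ∀ n y x p → n * - y - + 1 ≡ - x * p + - (+ 1 + y * n - x * p)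
    algebra = solve-∀
  ... | GCD.Bézout.-+ x y eq = + y , fromSigned (sym (bézout x p y n (algebra (+ n) (+ y) (+ x) (+ p)) eq))
          (Signed.divides (+ x) refl)
    where
    algebra : ∀ n y x p → n * y - + 1 ≡ x * p + - (+ 1 + x * p - y * n)
    algebra = solve-∀

  sumℤ-cong-≈ : ∀ {n} {f g : Vector n} → (∀ i → f i ≈ g i) → sumℤ f ≈ sumℤ g
  sumℤ-cong-≈ {zero}  f≈g = ≈-refl
  sumℤ-cong-≈ {suc n} f≈g = +-cong (f≈g zero) (sumℤ-cong-≈ (λ i → f≈g (suc i)))

  ·-congʳ-≈ : ∀ {n} (u : Vector n) {v v′ : Vector n} → (∀ c → v c ≈ v′ c) → u · v ≈ u · v′
  ·-congʳ-≈ u v≈v′ = sumℤ-cong-≈ (λ c → *-cong (≈-refl {u c}) (v≈v′ c))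

  ·-congˡ-≈ : ∀ {n} {u u′ : Vector n} (v : Vector n) → (∀ c → u c ≈ u′ c) → u · v ≈ u′ · v
  ·-congˡ-≈ v u≈u′ = sumℤ-cong-≈ (λ c → *-cong (u≈u′ c) (≈-refl {v c}))

module SchurElimination (p : ℕ) where
  open Congruence p

  module Elimination {m} (A : Matrix (3 ℕ.+ m) (3 ℕ.+ m)) (c : Matrix 3 3)
                     (schur : SchurOnto 3 p A c) (e : ℤ) where

    pos : Fin 3 → Fin (3 ℕ.+ m)
    pos s = s ↑ˡ m

    K : Matrix m m
    K a b = A (3 ↑ʳ a) (3 ↑ʳ b)

    row : Fin 3 → Vector m
    row s b = A (pos s) (3 ↑ʳ b)

    col : Fin 3 → Vector m
    col t a = A (3 ↑ʳ a) (pos t)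

    Y : Matrix m m
    Y = proj₁ schur

    KY≈I : ∀ a b → (K ⊗ Y) a b ≈ identity a b
    KY≈I a b = mk≈ (proj₁ (proj₂ schur) a b)

    YK≈I : ∀ a b → (Y ⊗ K) a b ≈ identity a b
    YK≈I a b = mk≈ (proj₁ (proj₂ (proj₂ schur)) a b)

    reduced : ∀ s t → A (pos s) (pos t) - row s · (Y *ᵥ col t) ≈ c s t
    reduced s t = mk≈ (proj₂ (proj₂ (proj₂ schur)) s t)

    K*ᵥY*ᵥ : ∀ v a → (K *ᵥ (Y *ᵥ v)) a ≈ v a
    K*ᵥY*ᵥ v a = ≈-trans (≈-reflexive (·-*ᵥ (K a) Y v))
      (≈-trans (·-congˡ-≈ v (KY≈I a)) (≈-reflexive (identity-*ᵥ v a)))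

    ᵥ*Yᵥ*K : ∀ v b → ((v ᵥ* Y) ᵥ* K) b ≈ v b
    ᵥ*Yᵥ*K v b = ≈-trans (≈-reflexive (sym (·-*ᵥ v Y (λ c → K c b))))
      (≈-trans (·-congʳ-≈ v (λ a → YK≈I a b)) (≈-reflexive (ᵥ*-identity v b)))

    α : ℤ
    α = A (pos 2F) (pos 2F)

    u u′ : Vector m
    u = row 2F
    u′ = col 2F

    z w : Vector m
    z = Y *ᵥ u′
    w = u ᵥ* Y

    σ : ℤ
    σ = α - u · z

    w·u′≡u·z : w · u′ ≡ u · z
    w·u′≡u·z = sym (·-*ᵥ u Y u′)

    open SetoidReasoning ≈-setoid

    module _ (c₂₂e≈1 : c 2F 2F * e ≈ + 1) where

      σe≈1 : σ * e ≈ + 1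
      σe≈1 = ≈-trans (*-cong (reduced 2F 2F) (≈-refl {e})) c₂₂e≈1

      -- Block inverse of [[α, uᵀ], [u′, K]]; e plays the role of σ⁻¹.
      X : Matrix (suc m) (suc m)
      X zero    zero    = e
      X zero    (suc b) = - e * w b
      X (suc a) zero    = - e * z a
      X (suc a) (suc b) = Y a b + e * (z a * w b)

      K′X≈I : ∀ a b → (blockSS A ⊗ X) a b ≈ identity a b
      K′X≈I zero zero = begin
        α * e + u · (λ c → - e * z c)  ≡⟨ cong (_+_ (α * e)) (·-scaleʳ (- e) u z) ⟩
        α * e + - e * (u · z)          ≡⟨ algebra α e (u · z) ⟩
        σ * e                          ≈⟨ σe≈1 ⟩
        + 1                            ∎
        where
        algebra : ∀ α e d → α * e + - e * d ≡ (α - d) * e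
        algebra = solve-∀
      K′X≈I zero (suc b) = begin
        α * (- e * w b) + u · (λ c → Y c b + e * (z c * w b))
          ≡⟨ cong (_+_ (α * (- e * w b))) (·-rankOneʳ u Y e z w b) ⟩
        α * (- e * w b) + (w b + e * (u · z) * w b)
          ≡⟨ algebra α e (w b) (u · z) ⟩
        + 0 + w b * (+ 1 - σ * e)
          ≈⟨ x+k[1-z]≈x (+ 0) (w b) σe≈1 ⟩
        + 0 ∎
        where
        algebra : ∀ α e w d → α * (- e * w) + (w + e * d * w) ≡ + 0 + w * (+ 1 - (α - d) * e)
        algebra = solve-∀
      K′X≈I (suc a) zero = begin
        u′ a * e + K a · (λ c → - e * z c) ≡⟨ cong (_+_ (u′ a * e)) (·-scaleʳ (- e) (K a) z) ⟩
        u′ a * e + - e * (K a · z)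
          ≈⟨ +-cong (≈-refl {u′ a * e}) (*-cong (≈-refl { - e}) (K*ᵥY*ᵥ u′ a)) ⟩
        u′ a * e + - e * u′ a
          ≡⟨ algebra (u′ a) e ⟩
        + 0 ∎
        where
        algebra : ∀ u e → u * e + - e * u ≡ + 0
        algebra = solve-∀
      K′X≈I (suc a) (suc b) = begin
        u′ a * (- e * w b) + K a · (λ c → Y c b + e * (z c * w b))
          ≡⟨ cong (_+_ (u′ a * (- e * w b))) (·-rankOneʳ (K a) Y e z w b) ⟩
        u′ a * (- e * w b) + ((K ⊗ Y) a b + e * (K a · z) * w b)
          ≈⟨ +-cong (≈-refl {u′ a * (- e * w b)})
               (+-cong (KY≈I a b) (*-cong (*-cong (≈-refl {e}) (K*ᵥY*ᵥ u′ a)) (≈-refl {w b}))) ⟩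
        u′ a * (- e * w b) + (identity a b + e * u′ a * w b)
          ≡⟨ algebra (u′ a) e (w b) (identity a b) ⟩
        identity a b ∎
        where
        algebra : ∀ u e w I → u * (- e * w) + (I + e * u * w) ≡ I
        algebra = solve-∀

      XK′≈I : ∀ a b → (X ⊗ blockSS A) a b ≈ identity a b
      XK′≈I zero zero = begin
        e * α + (λ c → - e * w c) · u′
          ≡⟨ cong (_+_ (e * α)) (trans (·-scaleˡ (- e) w u′) (cong (- e *_) w·u′≡u·z)) ⟩
        e * α + - e * (u · z)
          ≡⟨ algebra α e (u · z) ⟩
        σ * e
          ≈⟨ σe≈1 ⟩
        + 1 ∎
        where
        algebra : ∀ α e d → e * α + - e * d ≡ (α - d) * e
        algebra = solve-∀
      XK′≈I zero (suc b) = begin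
        e * u b + (λ c → - e * w c) · (λ c → K c b)
          ≡⟨ cong (_+_ (e * u b)) (·-scaleˡ (- e) w (λ c → K c b)) ⟩
        e * u b + - e * (w ᵥ* K) b
          ≈⟨ +-cong (≈-refl {e * u b}) (*-cong (≈-refl { - e}) (ᵥ*Yᵥ*K u b)) ⟩
        e * u b + - e * u b
          ≡⟨ algebra e (u b) ⟩
        + 0 ∎
        where
        algebra : ∀ e u → e * u + - e * u ≡ + 0
        algebra = solve-∀
      XK′≈I (suc a) zero = begin
        - e * z a * α + (λ c → Y a c + e * (z a * w c)) · u′
          ≡⟨ cong (_+_ (- e * z a * α)) (·-rankOneˡ Y e z w u′ a) ⟩
        - e * z a * α + (z a + e * z a * (w · u′))
          ≡⟨ cong (λ d → - e * z a * α + (z a + e * z a * d)) w·u′≡u·z ⟩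
        - e * z a * α + (z a + e * z a * (u · z))
          ≡⟨ algebra α e (z a) (u · z) ⟩
        + 0 + z a * (+ 1 - σ * e)
          ≈⟨ x+k[1-z]≈x (+ 0) (z a) σe≈1 ⟩
        + 0 ∎
        where
        algebra : ∀ α e z d → - e * z * α + (z + e * z * d) ≡ + 0 + z * (+ 1 - (α - d) * e)
        algebra = solve-∀
      XK′≈I (suc a) (suc b) = begin
        - e * z a * u b + (λ c → Y a c + e * (z a * w c)) · (λ c → K c b)
          ≡⟨ cong (_+_ (- e * z a * u b)) (·-rankOneˡ Y e z w (λ c → K c b) a) ⟩
        - e * z a * u b + ((Y ⊗ K) a b + e * z a * (w ᵥ* K) b)
          ≈⟨ +-cong (≈-refl { - e * z a * u b})
               (+-cong (YK≈I a b) (*-cong (≈-refl {e * z a}) (ᵥ*Yᵥ*K u b))) ⟩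
        - e * z a * u b + (identity a b + e * z a * u b)
          ≡⟨ algebra e (z a) (u b) (identity a b) ⟩
        identity a b ∎
        where
        algebra : ∀ e z u I → - e * z * u + (I + e * z * u) ≡ I
        algebra = solve-∀

      rowExt : Fin 3 → Vector (suc m)
      rowExt s b = A (pos s) (suc (suc b))

      colExt : Fin 3 → Vector (suc m)
      colExt t a = A (suc (suc a)) (pos t)

      g : Fin 3 → ℤ
      g t = A (pos 2F) (pos t) - u · (Y *ᵥ col t)

      X*ᵥcolExt-zero : ∀ t → (X *ᵥ colExt t) zero ≈ e * g t
      X*ᵥcolExt-zero t = begin
        e * γ + (λ c → - e * w c) · col t
          ≡⟨ cong (_+_ (e * γ)) (·-scaleˡ (- e) w (col t)) ⟩
        e * γ + - e * (w · col t)
          ≡⟨ cong (λ d → e * γ + - e * d) (sym (·-*ᵥ u Y (col t))) ⟩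
        e * γ + - e * (u · (Y *ᵥ col t))
          ≡⟨ algebra e γ (u · (Y *ᵥ col t)) ⟩
        e * g t ∎
        where
        γ = A (pos 2F) (pos t)
        algebra : ∀ e γ d → e * γ + - e * d ≡ e * (γ - d)
        algebra = solve-∀

      X*ᵥcolExt-suc : ∀ t a → (X *ᵥ colExt t) (suc a) ≈ (Y *ᵥ col t) a + - e * g t * z a
      X*ᵥcolExt-suc t a = begin
        - e * z a * γ + (λ c → Y a c + e * (z a * w c)) · col t
          ≡⟨ cong (_+_ (- e * z a * γ)) (·-rankOneˡ Y e z w (col t) a) ⟩
        - e * z a * γ + ((Y *ᵥ col t) a + e * z a * (w · col t))
          ≡⟨ cong (λ d → - e * z a * γ + ((Y *ᵥ col t) a + e * z a * d)) (sym (·-*ᵥ u Y (col t))) ⟩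
        - e * z a * γ + ((Y *ᵥ col t) a + e * z a * (u · (Y *ᵥ col t)))
          ≡⟨ algebra e (z a) γ ((Y *ᵥ col t) a) (u · (Y *ᵥ col t)) ⟩
        (Y *ᵥ col t) a + - e * g t * z a ∎
        where
        γ = A (pos 2F) (pos t)
        algebra : ∀ e z γ y d → - e * z * γ + (y + e * z * d) ≡ y + - e * (γ - d) * z
        algebra = solve-∀

      boundary : ∀ s t → A (pos s) (pos t) - rowExt s · (X *ᵥ colExt t) ≈ c s t - c s 2F * e * c 2F t
      boundary s t = begin
        A (pos s) (pos t) - rowExt s · (X *ᵥ colExt t)
          ≈⟨ +-cong (≈-refl {A (pos s) (pos t)}) (-‿cong (+-cong (*-cong (≈-refl {β}) (X*ᵥcolExt-zero t))
        (·-congʳ-≈ (row s) (X*ᵥcolExt-suc t)))) ⟩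
          A (pos s) (pos t) - (β * (e * g t) + row s · (λ a → (Y *ᵥ col t) a + - e * g t * z a))
          ≡⟨ cong (λ d → A (pos s) (pos t) - (β * (e * g t) + d))
        (trans (·-distribʳ-+ (row s) (Y *ᵥ col t) (λ a → - e * g t * z a))
          (cong (_+_ (row s · (Y *ᵥ col t))) (·-scaleʳ (- e * g t) (row s) z))) ⟩
          A (pos s) (pos t) - (β * (e * g t) + (row s · (Y *ᵥ col t) + - e * g t * (row s · z)))
          ≡⟨ algebra (A (pos s) (pos t)) β e (g t) (row s · (Y *ᵥ col t)) (row s · z) ⟩
        (A (pos s) (pos t) - row s · (Y *ᵥ col t)) - (β - row s · z) * e * g t
          ≈⟨ +-cong (reduced s t) (-‿cong (*-cong (*-cong (reduced s 2F) (≈-refl {e})) (reduced 2F t))) ⟩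
        c s t - c s 2F * e * c 2F t ∎
        where
        β = A (pos s) (pos 2F)
        algebra : ∀ a β e g P Q → a - (β * (e * g) + (P + - e * g * Q)) ≡ (a - P) - (β - Q) * e * g
        algebra = solve-∀

  schur-eliminate : ∀ {m} {A : Matrix (3 ℕ.+ m) (3 ℕ.+ m)} {c : Matrix 3 3} → SchurOnto 3 p A c →
                    ∀ {e} → c 2F 2F * e ≈ + 1 →
                    SchurIs p A (λ s t → c (s ↑ˡ 1) (t ↑ˡ 1) - c (s ↑ˡ 1) 2F * e * c 2F (t ↑ˡ 1))
  schur-eliminate {A = A} {c} schur {e} c₂₂e≈1 =
    X c₂₂e≈1
    , (λ a b → ≈⇒≡[mod] (K′X≈I c₂₂e≈1 a b))
    , (λ a b → ≈⇒≡[mod] (XK′≈I c₂₂e≈1 a b))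
    , boundary₂
    where
    open Elimination A c schur e
    boundary₂ : (λ s t → blockTT A s t - (blockTS A ⊗ (X c₂₂e≈1 ⊗ blockST A)) s t)
                ≋ (λ s t → c (s ↑ˡ 1) (t ↑ˡ 1) - c (s ↑ˡ 1) 2F * e * c 2F (t ↑ˡ 1)) [modM p ]
    boundary₂ 0F 0F = ≈⇒≡[mod] (boundary c₂₂e≈1 0F 0F)
    boundary₂ 0F 1F = ≈⇒≡[mod] (boundary c₂₂e≈1 0F 1F)
    boundary₂ 1F 0F = ≈⇒≡[mod] (boundary c₂₂e≈1 1F 0F)
    boundary₂ 1F 1F = ≈⇒≡[mod] (boundary c₂₂e≈1 1F 1F)

sumℕ-cong : ∀ {n} {f g : Fin n → ℕ} → (∀ i → f i ≡ g i) → sumℕ f ≡ sumℕ g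
sumℕ-cong {zero}  f≗g = refl
sumℕ-cong {suc n} f≗g = cong₂ ℕ._+_ (f≗g zero) (sumℕ-cong (λ i → f≗g (suc i)))

sumℕ-zero : ∀ n → sumℕ {n} (λ _ → 0) ≡ 0
sumℕ-zero zero    = refl
sumℕ-zero (suc n) = sumℕ-zero n

sumℕ-punchIn : ∀ {n} (f : Fin (suc n) → ℕ) i → sumℕ f ≡ f i ℕ.+ sumℕ (f ∘ punchIn i)
sumℕ-punchIn f zero = refl
sumℕ-punchIn {suc n} f (suc i) = trans (cong (f zero ℕ.+_) (sumℕ-punchIn (f ∘ suc) i))
  (x∙yz≈y∙xz (f zero) (f (suc i)) _)

sumℕ-distrib-+ : ∀ {n} (f g : Fin n → ℕ) → sumℕ (λ i → f i ℕ.+ g i) ≡ sumℕ f ℕ.+ sumℕ g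
sumℕ-distrib-+ {zero}  f g = refl
sumℕ-distrib-+ {suc n} f g = trans (cong (f zero ℕ.+ g zero ℕ.+_) (sumℕ-distrib-+ (f ∘ suc) (g ∘ suc)))
  (interchange (f zero) (g zero) (sumℕ (f ∘ suc)) (sumℕ (g ∘ suc)))

sumℕ-mono-≤ : ∀ {n} {f g : Fin n → ℕ} → (∀ i → f i ℕ.≤ g i) → sumℕ f ℕ.≤ sumℕ g
sumℕ-mono-≤ {zero}  f≤g = z≤n
sumℕ-mono-≤ {suc n} f≤g = ℕ.+-mono-≤ (f≤g zero) (sumℕ-mono-≤ (f≤g ∘ suc))

sumℕ-one : ∀ n → sumℕ {n} (λ _ → 1) ≡ n
sumℕ-one zero    = refl
sumℕ-one (suc n) = cong suc (sumℕ-one n)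

indicator : Bool → ℕ
indicator b = if b then 1 else 0

countTrue : ∀ {n} → (Fin n → Bool) → ℕ
countTrue f = sumℕ (indicator ∘ f)

totalDegree : ∀ {n} → Graph n → ℕ
totalDegree G = sumℕ (degree G)

edge : Bool → ℤ
edge b = if b then - (+ 1) else + 0

sumℕ-indicator-≟ : ∀ {n} (a : Fin n) → sumℕ (λ b → indicator (does (a ≟ b))) ≡ 1
sumℕ-indicator-≟ {suc n} zero    = cong suc (sumℕ-zero n)
sumℕ-indicator-≟ {suc n} (suc a) = sumℕ-indicator-≟ a

identity-diag : ∀ {n} (a : Fin n) → identity a a ≡ + 1
identity-diag a = cong (λ b → if b then + 1 else + 0) (dec-true (a ≟ a) refl)

identity-offdiag : ∀ {n} {a b : Fin n} → a ≢ b → identity a b ≡ + 0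
identity-offdiag {a = a} {b} a≢b = cong (λ b → if b then + 1 else + 0) (dec-false (a ≟ b) a≢b)

laplacian-diag : ∀ {n} (G : Graph n) a → laplacian G a a ≡ + degree G a
laplacian-diag G a with a ≟ a
... | yes _   = refl
... | no a≢a = contradiction refl a≢a

laplacian-offdiag : ∀ {n} (G : Graph n) {a b} → a ≢ b → laplacian G a b ≡ edge (adj G a b)
laplacian-offdiag G {a} {b} a≢b with a ≟ b
... | yes a≡b = contradiction a≡b a≢b
... | no _    = refl

size : ∀ {n} → Graph n → ℕ
size {n} G = n ℕ.+ totalDegree G

isNonzero : ℕ → ℤ → ℕ
isNonzero p x = if does (p ∣? ∣ x ∣) then 0 else 1

isNonzero≤1 : ∀ p x → isNonzero p x ℕ.≤ 1
isNonzero≤1 p x with does (p ∣? ∣ x ∣)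
... | true  = z≤n
... | false = ℕ.≤-refl

isNonzero-0 : ∀ p → isNonzero p (+ 0) ≡ 0
isNonzero-0 p = cong (λ d → if d then 0 else 1) (dec-true (p ∣? 0) (p ∣0))

isNonzero-laplacian : ∀ p {n} (G : Graph n) a b →
                      isNonzero p (laplacian G a b) ℕ.≤ indicator (does (a ≟ b)) ℕ.+ indicator (adj G a b)
isNonzero-laplacian p G a b with a ≟ b
... | yes _ = ℕ.≤-trans (isNonzero≤1 p (+ degree G a)) (ℕ.m≤m+n 1 _)
... | no _ with adj G a b
...   | true  = isNonzero≤1 p (- (+ 1))
...   | false = ℕ.≤-reflexive (isNonzero-0 p)

nnz-laplacian≤size : ∀ p {n} (G : Graph n) → nnz p (laplacian G) ℕ.≤ size G
nnz-laplacian≤size p {n} G = begin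
  nnz p (laplacian G)
    ≤⟨ sumℕ-mono-≤ (λ a → sumℕ-mono-≤ (isNonzero-laplacian p G a)) ⟩
  sumℕ (λ a → sumℕ (λ b → indicator (does (a ≟ b)) ℕ.+ indicator (adj G a b)))
    ≡⟨ sumℕ-cong (λ a → trans (sumℕ-distrib-+ _ (indicator ∘ adj G a))
                              (cong (ℕ._+ degree G a) (sumℕ-indicator-≟ a))) ⟩
  sumℕ (λ a → 1 ℕ.+ degree G a)
    ≡⟨ trans (sumℕ-distrib-+ (λ _ → 1) (degree G)) (cong (ℕ._+ totalDegree G) (sumℕ-one n)) ⟩
  size G ∎
  where open ℕ.≤-Reasoning

data Punched {n} (i : Fin (suc n)) : Fin (suc n) → Set where
  at    : Punched i i
  other : ∀ j → Punched i (punchIn i j)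

punched : ∀ {n} (i x : Fin (suc n)) → Punched i x
punched i x with i ≟ x
... | yes refl = at
... | no i≢x   = subst (Punched i) (Fin.punchIn-punchOut i≢x) (other (punchOut i≢x))

border : ∀ {A : Set} {n} → (Fin n → Fin n → A) → Fin (suc n) → (Fin n → A) → (Fin n → A) → A →
         Fin (suc n) → Fin (suc n) → A
border M i r c d = insertAt (λ u → insertAt (M u) i (c u)) i (insertAt r i d)

module _ {A : Set} {n} (M : Fin n → Fin n → A) (i : Fin (suc n)) (r c : Fin n → A) (d : A) where

  private
    rows : Fin n → Fin (suc n) → A
    rows u = insertAt (M u) i (c u)

  border-at-at : border M i r c d i i ≡ d
  border-at-at = trans (cong (λ row → row i) (insertAt-lookup rows i (insertAt r i d))) (insertAt-lookup r i d)

  border-at-punchIn : ∀ v → border M i r c d i (punchIn i v) ≡ r v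
  border-at-punchIn v =
    trans (cong (λ row → row (punchIn i v)) (insertAt-lookup rows i (insertAt r i d))) (insertAt-punchIn r i d v)

  border-punchIn-at : ∀ u → border M i r c d (punchIn i u) i ≡ c u
  border-punchIn-at u =
    trans (cong (λ row → row i) (insertAt-punchIn rows i (insertAt r i d) u)) (insertAt-lookup (M u) i (c u))

  border-punchIn-punchIn : ∀ u v → border M i r c d (punchIn i u) (punchIn i v) ≡ M u v
  border-punchIn-punchIn u v =
    trans (cong (λ row → row (punchIn i v)) (insertAt-punchIn rows i (insertAt r i d) u))
          (insertAt-punchIn (M u) i (c u) v)

insertVertex : ∀ {n} → Graph n → Fin (suc n) → (Fin n → Bool) → Graph (suc n)
insertVertex G i N = record { adj = border (adj G) i N N false ; sym = sym′ ; irrefl = irrefl′ }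
  where
  sym′ : ∀ x y → border (adj G) i N N false x y ≡ border (adj G) i N N false y x
  sym′ x y with punched i x | punched i y
  ... | at      | at      = refl
  ... | at      | other v = trans (border-at-punchIn (adj G) i N N false v) (sym (border-punchIn-at (adj G) i N N false v))
  ... | other u | at      = trans (border-punchIn-at (adj G) i N N false u) (sym (border-at-punchIn (adj G) i N N false u))
  ... | other u | other v = trans (border-punchIn-punchIn (adj G) i N N false u v)
                                  (trans (Graph.sym G u v) (sym (border-punchIn-punchIn (adj G) i N N false v u)))

  irrefl′ : ∀ x → border (adj G) i N N false x x ≡ false
  irrefl′ x with punched i x
  ... | at      = border-at-at (adj G) i N N false
  ... | other u = trans (border-punchIn-punchIn (adj G) i N N false u u) (irrefl G u)

module _ {n} (G : Graph n) (i : Fin (suc n)) (N : Fin n → Bool) where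

  private
    G′ = insertVertex G i N

  degree-insertVertex-at : degree G′ i ≡ countTrue N
  degree-insertVertex-at = trans (sumℕ-punchIn (λ y → indicator (adj G′ i y)) i)
    (cong₂ ℕ._+_ (cong indicator (border-at-at (adj G) i N N false))
                 (sumℕ-cong (λ v → cong indicator (border-at-punchIn (adj G) i N N false v))))

  degree-insertVertex-punchIn : ∀ u → degree G′ (punchIn i u) ≡ indicator (N u) ℕ.+ degree G u
  degree-insertVertex-punchIn u = trans (sumℕ-punchIn (λ y → indicator (adj G′ (punchIn i u) y)) i)
    (cong₂ ℕ._+_ (cong indicator (border-punchIn-at (adj G) i N N false u))
                 (sumℕ-cong (λ v → cong indicator (border-punchIn-punchIn (adj G) i N N false u v))))

  totalDegree-insertVertex : totalDegree G′ ≡ countTrue N ℕ.+ (countTrue N ℕ.+ totalDegree G)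
  totalDegree-insertVertex = begin
    sumℕ (degree G′)
      ≡⟨ sumℕ-punchIn (degree G′) i ⟩
    degree G′ i ℕ.+ sumℕ (λ u → degree G′ (punchIn i u))
      ≡⟨ cong₂ ℕ._+_ degree-insertVertex-at (sumℕ-cong degree-insertVertex-punchIn) ⟩
    countTrue N ℕ.+ sumℕ (λ u → indicator (N u) ℕ.+ degree G u)
      ≡⟨ cong (countTrue N ℕ.+_) (sumℕ-distrib-+ (indicator ∘ N) (degree G)) ⟩
    countTrue N ℕ.+ (countTrue N ℕ.+ totalDegree G) ∎
    where open ≡-Reasoning

  laplacian-insertVertex-at-at : laplacian G′ i i ≡ + countTrue N
  laplacian-insertVertex-at-at = trans (laplacian-diag G′ i) (cong +_ degree-insertVertex-at)

  laplacian-insertVertex-at-punchIn : ∀ v → laplacian G′ i (punchIn i v) ≡ edge (N v)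
  laplacian-insertVertex-at-punchIn v =
    trans (laplacian-offdiag G′ (λ eq → Fin.punchInᵢ≢i i v (sym eq)))
          (cong edge (border-at-punchIn (adj G) i N N false v))

  laplacian-insertVertex-punchIn-at : ∀ u → laplacian G′ (punchIn i u) i ≡ edge (N u)
  laplacian-insertVertex-punchIn-at u =
    trans (laplacian-offdiag G′ (Fin.punchInᵢ≢i i u))
          (cong edge (border-punchIn-at (adj G) i N N false u))

  laplacian-insertVertex-punchIn : ∀ u v → laplacian G′ (punchIn i u) (punchIn i v)
                                           ≡ laplacian G u v + (if N u then identity u v else + 0)
  laplacian-insertVertex-punchIn u v = by-cases (u ≟ v)
    where
    open ≡-Reasoning
    by-cases : Dec (u ≡ v) → laplacian G′ (punchIn i u) (punchIn i v)
                             ≡ laplacian G u v + (if N u then identity u v else + 0)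
    by-cases (yes refl) = begin
      laplacian G′ (punchIn i u) (punchIn i u)
        ≡⟨ trans (laplacian-diag G′ (punchIn i u)) (cong +_ (degree-insertVertex-punchIn u)) ⟩
      + (indicator (N u) ℕ.+ degree G u)
        ≡⟨ cong +_ (ℕ.+-comm (indicator (N u)) (degree G u)) ⟩
      + (degree G u ℕ.+ indicator (N u))
        ≡⟨ ℤ.pos-+ (degree G u) (indicator (N u)) ⟩
      + degree G u + + indicator (N u)
        ≡⟨ cong₂ _+_ (sym (laplacian-diag G u)) (indicator-identity (N u)) ⟩
      laplacian G u u + (if N u then identity u u else + 0) ∎
      where
      indicator-identity : ∀ b → + indicator b ≡ (if b then identity u u else + 0)
      indicator-identity true  = sym (identity-diag u)
      indicator-identity false = refl
    by-cases (no u≢v) = begin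
      laplacian G′ (punchIn i u) (punchIn i v)
        ≡⟨ laplacian-offdiag G′ (u≢v ∘ Fin.punchIn-injective i u v) ⟩
      edge (adj G′ (punchIn i u) (punchIn i v))
        ≡⟨ cong edge (border-punchIn-punchIn (adj G) i N N false u v) ⟩
      edge (adj G u v)
        ≡⟨ sym (laplacian-offdiag G u≢v) ⟩
      laplacian G u v
        ≡⟨ sym (ℤ.+-identityʳ (laplacian G u v)) ⟩
      laplacian G u v + + 0
        ≡⟨ cong (_+_ (laplacian G u v)) (vanishes (N u)) ⟩
      laplacian G u v + (if N u then identity u v else + 0) ∎
      where
      vanishes : ∀ b → + 0 ≡ (if b then identity u v else + 0)
      vanishes true  = sym (identity-offdiag u≢v)
      vanishes false = refl

size-insertVertex : ∀ {n} (G : Graph n) i N → size (insertVertex G i N) ≡ 1 ℕ.+ 2 ℕ.* countTrue N ℕ.+ size G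
size-insertVertex {n} G i N = trans (cong (suc n ℕ.+_) (totalDegree-insertVertex G i N))
  (algebra n (countTrue N) (totalDegree G))
  where
  algebra : ∀ n c d → suc n ℕ.+ (c ℕ.+ (c ℕ.+ d)) ≡ 1 ℕ.+ 2 ℕ.* c ℕ.+ (n ℕ.+ d)
  algebra = ℕ-Solver.solve-∀

punchIn-↑ˡ : ∀ {k} m (i : Fin (suc k)) (s : Fin k) → punchIn (i ↑ˡ m) (s ↑ˡ m) ≡ punchIn i s ↑ˡ m
punchIn-↑ˡ m zero    s       = refl
punchIn-↑ˡ m (suc i) zero    = refl
punchIn-↑ˡ m (suc i) (suc s) = cong suc (punchIn-↑ˡ m i s)

punchIn-↑ʳ : ∀ {k} m (i : Fin (suc k)) (x : Fin m) → punchIn (i ↑ˡ m) (k ↑ʳ x) ≡ suc k ↑ʳ x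
punchIn-↑ʳ         m zero    x = refl
punchIn-↑ʳ {suc k} m (suc i) x = cong suc (punchIn-↑ʳ m i x)

identity-↑ˡ : ∀ {k} m (s t : Fin k) → identity (s ↑ˡ m) (t ↑ˡ m) ≡ identity s t
identity-↑ˡ m zero    zero    = refl
identity-↑ˡ m zero    (suc t) = refl
identity-↑ˡ m (suc s) zero    = refl
identity-↑ˡ m (suc s) (suc t) = identity-↑ˡ m s t

identity-↑ˡ-↑ʳ : ∀ {k} m (s : Fin k) (x : Fin m) → identity (s ↑ˡ m) (k ↑ʳ x) ≡ + 0
identity-↑ˡ-↑ʳ m zero    x = refl
identity-↑ˡ-↑ʳ m (suc s) x = identity-↑ˡ-↑ʳ m s x

onFirst : ∀ k {m} → (Fin k → Bool) → Fin (k ℕ.+ m) → Bool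
onFirst zero    nbr x       = false
onFirst (suc k) nbr zero    = nbr zero
onFirst (suc k) nbr (suc x) = onFirst k (nbr ∘ suc) x

onFirst-↑ˡ : ∀ {k} m (nbr : Fin k → Bool) s → onFirst k {m} nbr (s ↑ˡ m) ≡ nbr s
onFirst-↑ˡ m nbr zero    = refl
onFirst-↑ˡ m nbr (suc s) = onFirst-↑ˡ m (nbr ∘ suc) s

onFirst-↑ʳ : ∀ {k m} (nbr : Fin k → Bool) x → onFirst k {m} nbr (k ↑ʳ x) ≡ false
onFirst-↑ʳ {zero}  nbr x = refl
onFirst-↑ʳ {suc k} nbr x = onFirst-↑ʳ (nbr ∘ suc) x

countTrue-onFirst : ∀ k {m} (nbr : Fin k → Bool) → countTrue (onFirst k {m} nbr) ≡ countTrue nbr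
countTrue-onFirst zero    {m} nbr = sumℕ-zero m
countTrue-onFirst (suc k)     nbr = cong (indicator (nbr zero) ℕ.+_) (countTrue-onFirst k (nbr ∘ suc))

-- B plus the Laplacian of the star joining a new vertex at index i to the terminals in nbr.
starExtension : ∀ {k} → Matrix k k → Fin (suc k) → (Fin k → Bool) → Matrix (suc k) (suc k)
starExtension B i nbr =
  border (λ s t → B s t + (if nbr s then identity s t else + 0)) i (edge ∘ nbr) (edge ∘ nbr) (+ countTrue nbr)

module StarAttachment {k m} (G : Graph (k ℕ.+ m)) (i : Fin (suc k)) (nbr : Fin k → Bool) where

  attached : Graph (suc k ℕ.+ m)
  attached = insertVertex G (i ↑ˡ m) (onFirst k nbr)

  private
    L = laplacian G
    L′ = laplacian attached
    ν = i ↑ˡ m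
    N = onFirst k {m} nbr

    vanishing : ∀ b {x} → x ≡ + 0 → (if b then x else + 0) ≡ + 0
    vanishing true  x≡0 = x≡0
    vanishing false _   = refl

    +0-right : ∀ x {y} → y ≡ + 0 → x + y ≡ x
    +0-right x y≡0 = trans (cong (_+_ x) y≡0) (ℤ.+-identityʳ x)

  L′-interior : ∀ a b → L′ (suc k ↑ʳ a) (suc k ↑ʳ b) ≡ L (k ↑ʳ a) (k ↑ʳ b)
  L′-interior a b = begin
    L′ (suc k ↑ʳ a) (suc k ↑ʳ b)
      ≡⟨ cong₂ L′ (sym (punchIn-↑ʳ m i a)) (sym (punchIn-↑ʳ m i b)) ⟩
    L′ (punchIn ν (k ↑ʳ a)) (punchIn ν (k ↑ʳ b))
      ≡⟨ laplacian-insertVertex-punchIn G ν N (k ↑ʳ a) (k ↑ʳ b) ⟩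
    L (k ↑ʳ a) (k ↑ʳ b) + (if N (k ↑ʳ a) then identity (k ↑ʳ a) (k ↑ʳ b) else + 0)
      ≡⟨ +0-right _ (cong (λ c → if c then identity (k ↑ʳ a) (k ↑ʳ b) else + 0) (onFirst-↑ʳ nbr a)) ⟩
    L (k ↑ʳ a) (k ↑ʳ b) ∎
    where open ≡-Reasoning

  L′-row : ∀ s x → L′ (punchIn i s ↑ˡ m) (suc k ↑ʳ x) ≡ L (s ↑ˡ m) (k ↑ʳ x)
  L′-row s x = begin
    L′ (punchIn i s ↑ˡ m) (suc k ↑ʳ x)
      ≡⟨ cong₂ L′ (sym (punchIn-↑ˡ m i s)) (sym (punchIn-↑ʳ m i x)) ⟩
    L′ (punchIn ν (s ↑ˡ m)) (punchIn ν (k ↑ʳ x))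
      ≡⟨ laplacian-insertVertex-punchIn G ν N (s ↑ˡ m) (k ↑ʳ x) ⟩
    L (s ↑ˡ m) (k ↑ʳ x) + (if N (s ↑ˡ m) then identity (s ↑ˡ m) (k ↑ʳ x) else + 0)
      ≡⟨ +0-right _ (vanishing (N (s ↑ˡ m)) (identity-↑ˡ-↑ʳ m s x)) ⟩
    L (s ↑ˡ m) (k ↑ʳ x) ∎
    where open ≡-Reasoning

  L′-col : ∀ t x → L′ (suc k ↑ʳ x) (punchIn i t ↑ˡ m) ≡ L (k ↑ʳ x) (t ↑ˡ m)
  L′-col t x = begin
    L′ (suc k ↑ʳ x) (punchIn i t ↑ˡ m)
      ≡⟨ cong₂ L′ (sym (punchIn-↑ʳ m i x)) (sym (punchIn-↑ˡ m i t)) ⟩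
    L′ (punchIn ν (k ↑ʳ x)) (punchIn ν (t ↑ˡ m))
      ≡⟨ laplacian-insertVertex-punchIn G ν N (k ↑ʳ x) (t ↑ˡ m) ⟩
    L (k ↑ʳ x) (t ↑ˡ m) + (if N (k ↑ʳ x) then identity (k ↑ʳ x) (t ↑ˡ m) else + 0)
      ≡⟨ +0-right _ (cong (λ c → if c then identity (k ↑ʳ x) (t ↑ˡ m) else + 0) (onFirst-↑ʳ nbr x)) ⟩
    L (k ↑ʳ x) (t ↑ˡ m) ∎
    where open ≡-Reasoning

  L′-newRow : ∀ x → L′ ν (suc k ↑ʳ x) ≡ + 0
  L′-newRow x = trans (cong (L′ ν) (sym (punchIn-↑ʳ m i x)))
    (trans (laplacian-insertVertex-at-punchIn G ν N (k ↑ʳ x)) (cong edge (onFirst-↑ʳ nbr x)))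

  L′-newCol : ∀ x → L′ (suc k ↑ʳ x) ν ≡ + 0
  L′-newCol x = trans (cong (λ y → L′ y ν) (sym (punchIn-↑ʳ m i x)))
    (trans (laplacian-insertVertex-punchIn-at G ν N (k ↑ʳ x)) (cong edge (onFirst-↑ʳ nbr x)))

  L′-old-old : ∀ s t → L′ (punchIn i s ↑ˡ m) (punchIn i t ↑ˡ m)
                       ≡ L (s ↑ˡ m) (t ↑ˡ m) + (if nbr s then identity s t else + 0)
  L′-old-old s t = begin
    L′ (punchIn i s ↑ˡ m) (punchIn i t ↑ˡ m)
      ≡⟨ cong₂ L′ (sym (punchIn-↑ˡ m i s)) (sym (punchIn-↑ˡ m i t)) ⟩
    L′ (punchIn ν (s ↑ˡ m)) (punchIn ν (t ↑ˡ m))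
      ≡⟨ laplacian-insertVertex-punchIn G ν N (s ↑ˡ m) (t ↑ˡ m) ⟩
    L (s ↑ˡ m) (t ↑ˡ m) + (if N (s ↑ˡ m) then identity (s ↑ˡ m) (t ↑ˡ m) else + 0)
      ≡⟨ cong₂ (λ c d → L (s ↑ˡ m) (t ↑ˡ m) + (if c then d else + 0))
               (onFirst-↑ˡ m nbr s) (identity-↑ˡ m s t) ⟩
    L (s ↑ˡ m) (t ↑ˡ m) + (if nbr s then identity s t else + 0) ∎
    where open ≡-Reasoning

  L′-new-old : ∀ t → L′ ν (punchIn i t ↑ˡ m) ≡ edge (nbr t)
  L′-new-old t = trans (cong (L′ ν) (sym (punchIn-↑ˡ m i t)))
    (trans (laplacian-insertVertex-at-punchIn G ν N (t ↑ˡ m)) (cong edge (onFirst-↑ˡ m nbr t)))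

  L′-old-new : ∀ s → L′ (punchIn i s ↑ˡ m) ν ≡ edge (nbr s)
  L′-old-new s = trans (cong (λ y → L′ y ν) (sym (punchIn-↑ˡ m i s)))
    (trans (laplacian-insertVertex-punchIn-at G ν N (s ↑ˡ m)) (cong edge (onFirst-↑ˡ m nbr s)))

  L′-new-new : L′ ν ν ≡ + countTrue nbr
  L′-new-new = trans (laplacian-insertVertex-at-at G ν N) (cong +_ (countTrue-onFirst k nbr))

  module _ (p : ℕ) {B : Matrix k k} (schur : SchurOnto k p L B) where
    open Congruence p

    private
      Y = proj₁ schur
      B′ = starExtension B i nbr

      row′ col′ : Fin (suc k) → Vector m
      row′ a x = L′ (a ↑ˡ m) (suc k ↑ʳ x)
      col′ b x = L′ (suc k ↑ʳ x) (b ↑ˡ m)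

      reduced : ∀ s t → L (s ↑ˡ m) (t ↑ˡ m) - (λ x → L (s ↑ˡ m) (k ↑ʳ x)) · (Y *ᵥ (λ x → L (k ↑ʳ x) (t ↑ˡ m)))
                        ≈ B s t
      reduced s t = mk≈ (proj₂ (proj₂ (proj₂ schur)) s t)

      minus-zero : ∀ x {y} → y ≡ + 0 → x - y ≡ x
      minus-zero x refl = ℤ.+-identityʳ x

    entry : ∀ a b → Punched i a → Punched i b →
            L′ (a ↑ˡ m) (b ↑ˡ m) - row′ a · (Y *ᵥ col′ b) ≈ B′ a b
    entry _ _ at at = ≈-reflexive (begin
      L′ ν ν - row′ i · (Y *ᵥ col′ i)
        ≡⟨ minus-zero (L′ ν ν) (·-zeroˡ (Y *ᵥ col′ i) L′-newRow) ⟩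
      L′ ν ν
        ≡⟨ L′-new-new ⟩
      + countTrue nbr
        ≡⟨ sym (border-at-at _ i (edge ∘ nbr) (edge ∘ nbr) (+ countTrue nbr)) ⟩
      B′ i i ∎)
      where open ≡-Reasoning
    entry _ _ at (other t) = ≈-reflexive (begin
      L′ ν (punchIn i t ↑ˡ m) - row′ i · (Y *ᵥ col′ (punchIn i t))
        ≡⟨ minus-zero _ (·-zeroˡ (Y *ᵥ col′ (punchIn i t)) L′-newRow) ⟩
      L′ ν (punchIn i t ↑ˡ m)
        ≡⟨ L′-new-old t ⟩
      edge (nbr t)
        ≡⟨ sym (border-at-punchIn _ i (edge ∘ nbr) (edge ∘ nbr) (+ countTrue nbr) t) ⟩
      B′ i (punchIn i t) ∎)
      where open ≡-Reasoning
    entry _ _ (other s) at = ≈-reflexive (begin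
      L′ (punchIn i s ↑ˡ m) ν - row′ (punchIn i s) · (Y *ᵥ col′ i)
        ≡⟨ minus-zero _ (·-*ᵥ-zeroʳ (row′ (punchIn i s)) Y L′-newCol) ⟩
      L′ (punchIn i s ↑ˡ m) ν
        ≡⟨ L′-old-new s ⟩
      edge (nbr s)
        ≡⟨ sym (border-punchIn-at _ i (edge ∘ nbr) (edge ∘ nbr) (+ countTrue nbr) s) ⟩
      B′ (punchIn i s) i ∎)
      where open ≡-Reasoning
    entry _ _ (other s) (other t) = begin
      L′ (punchIn i s ↑ˡ m) (punchIn i t ↑ˡ m) - row′ (punchIn i s) · (Y *ᵥ col′ (punchIn i t))
        ≡⟨ cong₂ _-_ (L′-old-old s t) (·-*ᵥ-cong Y (L′-row s) (L′-col t)) ⟩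
      (L (s ↑ˡ m) (t ↑ˡ m) + δ) - P
        ≡⟨ algebra (L (s ↑ˡ m) (t ↑ˡ m)) δ P ⟩
      (L (s ↑ˡ m) (t ↑ˡ m) - P) + δ
        ≈⟨ +-cong (reduced s t) (≈-refl {δ}) ⟩
      B s t + δ
        ≡⟨ sym (border-punchIn-punchIn _ i (edge ∘ nbr) (edge ∘ nbr) (+ countTrue nbr) s t) ⟩
      B′ (punchIn i s) (punchIn i t) ∎
      where
      open SetoidReasoning ≈-setoid
      δ = if nbr s then identity s t else + 0
      P = (λ x → L (s ↑ˡ m) (k ↑ʳ x)) · (Y *ᵥ (λ x → L (k ↑ʳ x) (t ↑ˡ m)))
      algebra : ∀ l δ P → (l + δ) - P ≡ (l - P) + δ
      algebra = solve-∀

    schurOnto-attached : SchurOnto (suc k) p L′ B′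
    schurOnto-attached = Y , KY′ , YK′ , (λ a b → ≈⇒≡[mod] (entry a b (punched i a) (punched i b)))
      where
      KY′ : ∀ a b → sumℤ (λ c → L′ (suc k ↑ʳ a) (suc k ↑ʳ c) * Y c b) ≡ identity a b [mod p ]
      KY′ a b = subst (λ x → x ≡ identity a b [mod p ])
        (sumℤ-cong (λ c → cong (_* Y c b) (sym (L′-interior a c)))) (proj₁ (proj₂ schur) a b)
      YK′ : ∀ a b → sumℤ (λ c → Y a c * L′ (suc k ↑ʳ c) (suc k ↑ʳ b)) ≡ identity a b [mod p ]
      YK′ a b = subst (λ x → x ≡ identity a b [mod p ])
        (sumℤ-cong (λ c → cong (Y a c *_) (sym (L′-interior c b)))) (proj₁ (proj₂ (proj₂ schur)) a b)

seriesNeighbours : Fin 2 → Bool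
seriesNeighbours 0F = false
seriesNeighbours 1F = true

-- The new vertex takes position 0 and is joined to the old terminal 1, which moves to
-- position 2 and is eliminated: a unit resistor in series.
series : ∀ {m} (G : Graph (2 ℕ.+ m)) → Graph (2 ℕ.+ suc m)
series {m} G = StarAttachment.attached {2} {m} G 0F seriesNeighbours

-- The new vertex takes position 2, is joined to both terminals and is eliminated:
-- a resistor of 2 in parallel.
parallelPath : ∀ {m} (G : Graph (2 ℕ.+ m)) → Graph (2 ℕ.+ suc m)
parallelPath {m} G = StarAttachment.attached {2} {m} G 2F (λ _ → true)

size-series : ∀ {m} (G : Graph (2 ℕ.+ m)) → size (series G) ≡ 3 ℕ.+ size G
size-series {m} G = trans (size-insertVertex G 0F (onFirst 2 seriesNeighbours))
  (cong (λ c → 1 ℕ.+ 2 ℕ.* c ℕ.+ size G) (countTrue-onFirst 2 {m} seriesNeighbours))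

size-parallelPath : ∀ {m} (G : Graph (2 ℕ.+ m)) → size (parallelPath G) ≡ 5 ℕ.+ size G
size-parallelPath {m} G = trans (size-insertVertex G 2F (onFirst 2 (λ _ → true)))
  (cong (λ c → 1 ℕ.+ 2 ℕ.* c ℕ.+ size G) (countTrue-onFirst 2 {m} (λ _ → true)))

module Circuits (p : ℕ) where
  open Congruence p
  open SchurElimination p using (schur-eliminate)

  IsCircuit : ∀ {m} → Graph (2 ℕ.+ m) → ℤ → Set
  IsCircuit G r = SchurIs p (laplacian G) (scale r e12)

  schurIs-cong : ∀ {m} {A : Matrix (2 ℕ.+ m) (2 ℕ.+ m)} {B B′ : Matrix 2 2} →
                 (∀ s t → B s t ≈ B′ s t) → SchurIs p A B → SchurIs p A B′
  schurIs-cong {A = A} B≈B′ (X , KX , XK , schur) = X , KX , XK , λ s t →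
    ≈⇒≡[mod] (≈-trans {blockTT A s t - (blockTS A ⊗ (X ⊗ blockST A)) s t} (mk≈ (schur s t)) (B≈B′ s t))

  ≈-scale-e12 : ∀ {M : Matrix 2 2} {r} → M 0F 0F ≈ r → M 0F 1F ≈ - r → M 1F 0F ≈ - r → M 1F 1F ≈ r →
                ∀ s t → M s t ≈ scale r e12 s t
  ≈-scale-e12 {M} {r} m₀₀ m₀₁ m₁₀ m₁₁ = entries
    where
    minus : r * - (+ 1) ≡ - r
    minus = trans (ℤ.*-comm r (- (+ 1))) (ℤ.-1*i≡-i r)
    entries : ∀ s t → M s t ≈ scale r e12 s t
    entries 0F 0F = ≈-trans m₀₀ (≈-reflexive (sym (ℤ.*-identityʳ r)))
    entries 0F 1F = ≈-trans m₀₁ (≈-reflexive (sym minus))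
    entries 1F 0F = ≈-trans m₁₀ (≈-reflexive (sym minus))
    entries 1F 1F = ≈-trans m₁₁ (≈-reflexive (sym (ℤ.*-identityʳ r)))

  series-isCircuit : ∀ {m} {G : Graph (2 ℕ.+ m)} {r e} → IsCircuit G r → (+ 1 + r) * e ≈ + 1 →
                     IsCircuit (series G) (r * e)
  series-isCircuit {m} {G} {r} {e} circuit [1+r]e≈1 = schurIs-cong {A = laplacian (series G)}
    (≈-scale-e12 (≈-trans (≈-reflexive (algebra₀₀ r e)) (x+k[1-z]≈x (r * e) (+ 1) [1+r]e≈1))
                 (≈-reflexive (algebra₀₁ r e))
                 (≈-reflexive (algebra₁₀ r e))
                 (≈-trans (≈-reflexive (algebra₁₁ r e)) (x+k[1-z]≈x (r * e) r [1+r]e≈1)))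
    (schur-eliminate {A = laplacian (series G)} {c = starExtension (scale r e12) 0F seriesNeighbours}
                     (StarAttachment.schurOnto-attached {2} {m} G 0F seriesNeighbours p circuit)
                     (≈-trans (≈-reflexive (algebra₂₂ r e)) [1+r]e≈1))
    where
    algebra₂₂ : ∀ r e → (r * + 1 + + 1) * e ≡ (+ 1 + r) * e
    algebra₂₂ = solve-∀
    algebra₀₀ : ∀ r e → + 1 - - (+ 1) * e * - (+ 1) ≡ r * e + + 1 * (+ 1 - (+ 1 + r) * e)
    algebra₀₀ = solve-∀
    algebra₀₁ : ∀ r e → + 0 - - (+ 1) * e * (r * - (+ 1) + + 0) ≡ - (r * e)
    algebra₀₁ = solve-∀
    algebra₁₀ : ∀ r e → + 0 - (r * - (+ 1) + + 0) * e * - (+ 1) ≡ - (r * e)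
    algebra₁₀ = solve-∀
    algebra₁₁ : ∀ r e → (r * + 1 + + 0) - (r * - (+ 1) + + 0) * e * (r * - (+ 1) + + 0)
                        ≡ r * e + r * (+ 1 - (+ 1 + r) * e)
    algebra₁₁ = solve-∀

  parallelPath-isCircuit : ∀ {m} {G : Graph (2 ℕ.+ m)} {r h} → IsCircuit G r → + 2 * h ≈ + 1 →
                           IsCircuit (parallelPath G) (r + h)
  parallelPath-isCircuit {m} {G} {r} {h} circuit 2h≈1 = schurIs-cong {A = laplacian (parallelPath G)}
    (≈-scale-e12 (≈-trans (≈-reflexive (diagonal r h)) (x+k[1-z]≈x (r + h) (+ 1) 2h≈1))
                 (≈-reflexive (offDiagonal r h))
                 (≈-reflexive (offDiagonal r h))
                 (≈-trans (≈-reflexive (diagonal r h)) (x+k[1-z]≈x (r + h) (+ 1) 2h≈1)))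
    (schur-eliminate {A = laplacian (parallelPath G)} {c = starExtension (scale r e12) 2F (λ _ → true)}
                     (StarAttachment.schurOnto-attached {2} {m} G 2F (λ _ → true) p circuit) 2h≈1)
    where
    diagonal : ∀ r h → (r * + 1 + + 1) - - (+ 1) * h * - (+ 1) ≡ (r + h) + + 1 * (+ 1 - + 2 * h)
    diagonal = solve-∀
    offDiagonal : ∀ r h → (r * - (+ 1) + + 0) - - (+ 1) * h * - (+ 1) ≡ - (r + h)
    offDiagonal = solve-∀

edgeAdj : Fin 2 → Fin 2 → Bool
edgeAdj 0F 0F = false
edgeAdj 0F 1F = true
edgeAdj 1F 0F = true
edgeAdj 1F 1F = false

singleEdge : Graph (2 ℕ.+ 0)
singleEdge = record { adj = edgeAdj ; sym = symmetric ; irrefl = irreflexive }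
  where
  symmetric : ∀ a b → edgeAdj a b ≡ edgeAdj b a
  symmetric 0F 0F = refl
  symmetric 0F 1F = refl
  symmetric 1F 0F = refl
  symmetric 1F 1F = refl
  irreflexive : ∀ a → edgeAdj a a ≡ false
  irreflexive 0F = refl
  irreflexive 1F = refl

module Construction (p : ℕ) (p-prime : Prime p) where
  open Congruence p
  open Circuits p

  singleEdge-isCircuit : IsCircuit singleEdge (+ 1)
  singleEdge-isCircuit = (λ ()) , (λ ()) , (λ ()) , λ s t → ≈⇒≡[mod] (entries s t)
    where
    entries : ∀ s t → blockTT (laplacian singleEdge) s t - + 0 ≈ scale (+ 1) e12 s t
    entries 0F 0F = ≈-refl
    entries 0F 1F = ≈-refl
    entries 1F 0F = ≈-refl
    entries 1F 1F = ≈-refl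

  record Circuit (a b : ℕ) : Set where
    field
      {m}         : ℕ
      graph       : Graph (2 ℕ.+ m)
      conductance : ℤ
      isCircuit   : IsCircuit graph conductance
      ratio       : conductance * + b ≈ + a
      small       : size graph ℕ.≤ 10 ℕ.* (a ℕ.+ b)

  edgeCircuit : ∀ {a} → 1 ℕ.≤ a → Circuit a a
  edgeCircuit {a} 1≤a = record
    { graph = singleEdge ; conductance = + 1 ; isCircuit = singleEdge-isCircuit
    ; ratio = ≈-reflexive (ℤ.*-identityˡ (+ a))
    ; small = ℕ.≤-trans (ℕ.m≤m+n 4 16) (ℕ.*-monoʳ-≤ 10 (ℕ.+-mono-≤ 1≤a 1≤a))
    }

  private
    growth : ∀ {s n} c d → s ℕ.≤ 10 ℕ.* n → c ℕ.≤ 10 → 1 ℕ.≤ d →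
             c ℕ.+ s ℕ.≤ 10 ℕ.* (d ℕ.+ n)
    growth {s} {n} c d s≤10n c≤10 1≤d = begin
      c ℕ.+ s                 ≤⟨ ℕ.+-mono-≤ c≤10 s≤10n ⟩
      10 ℕ.+ 10 ℕ.* n         ≤⟨ ℕ.+-monoˡ-≤ (10 ℕ.* n) (ℕ.*-monoʳ-≤ 10 1≤d) ⟩
      10 ℕ.* d ℕ.+ 10 ℕ.* n   ≡⟨ ℕ.*-distribˡ-+ 10 d n ⟨
      10 ℕ.* (d ℕ.+ n)        ∎
      where open ℕ.≤-Reasoning

  seriesCircuit : ∀ {a b} → 1 ℕ.≤ a → a ℕ.+ b ℕ.< p → Circuit a b → Circuit a (a ℕ.+ b)
  seriesCircuit {a} {b} 1≤a a+b<p C = record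
    { graph = series graph
    ; conductance = r * e
    ; isCircuit = series-isCircuit {r = r} {e} isCircuit [1+r]e≈1
    ; ratio = begin
        r * e * + (a ℕ.+ b)         ≡⟨ algebra r (+ b) v (+ (a ℕ.+ b)) ⟩
        r * + b * (+ (a ℕ.+ b) * v) ≈⟨ *-cong ratio (proj₂ a+b⁻¹) ⟩
        + a * + 1                   ≡⟨ ℤ.*-identityʳ (+ a) ⟩
        + a                         ∎
    ; small = subst (ℕ._≤ 10 ℕ.* (a ℕ.+ (a ℕ.+ b))) (sym (size-series graph))
                    (growth 3 a small (ℕ.m≤m+n 3 7) 1≤a)
    }
    where
    open Circuit C renaming (conductance to r)
    open SetoidReasoning ≈-setoid
    a+b⁻¹ = inverse p-prime (ℕ.<-≤-trans (s≤s z≤n) (ℕ.≤-trans 1≤a (ℕ.m≤m+n a b))) a+b<p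
    v = proj₁ a+b⁻¹
    e = + b * v
    algebra : ∀ r b v n → r * (b * v) * n ≡ r * b * (n * v)
    algebra = solve-∀
    [1+r]e≈1 : (+ 1 + r) * e ≈ + 1
    [1+r]e≈1 = begin
      (+ 1 + r) * (+ b * v)  ≡⟨ algebra′ r (+ b) v ⟩
      (+ b + r * + b) * v    ≈⟨ *-cong (+-cong (≈-refl {+ b}) ratio) (≈-refl {v}) ⟩
      (+ b + + a) * v        ≡⟨ cong (_* v) (trans (ℤ.+-comm (+ b) (+ a)) (sym (ℤ.pos-+ a b))) ⟩
      + (a ℕ.+ b) * v        ≈⟨ proj₂ a+b⁻¹ ⟩
      + 1                    ∎
      where
      algebra′ : ∀ r b v → (+ 1 + r) * (b * v) ≡ (b + r * b) * v
      algebra′ = solve-∀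

  parallelCircuit : ∀ {a b} → 1 ℕ.≤ b → 2 ℕ.< p → Circuit a b → Circuit (a ℕ.+ b) b
  parallelCircuit {a} {b} 1≤b 2<p C = record
    { graph = parallelPath (parallelPath graph)
    ; conductance = r + h + h
    ; isCircuit = parallelPath-isCircuit {r = r + h} {h} (parallelPath-isCircuit {r = r} {h} isCircuit 2h≈1) 2h≈1
    ; ratio = begin
        (r + h + h) * + b
          ≡⟨ algebra r h (+ b) ⟩
        r * + b + + 2 * h * + b
          ≈⟨ +-cong ratio (*-cong 2h≈1 (≈-refl {+ b})) ⟩
        + a + + 1 * + b
          ≡⟨ trans (cong (_+_ (+ a)) (ℤ.*-identityˡ (+ b))) (sym (ℤ.pos-+ a b)) ⟩
        + (a ℕ.+ b) ∎
    ; small = subst₂ ℕ._≤_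
                     (sym (trans (size-parallelPath (parallelPath graph)) (cong (5 ℕ.+_) (size-parallelPath graph))))
                           (cong (10 ℕ.*_) (ℕ.+-comm b (a ℕ.+ b)))
                           (growth 10 b small ℕ.≤-refl 1≤b)
    }
    where
    open Circuit C renaming (conductance to r)
    open SetoidReasoning ≈-setoid
    ½ = inverse p-prime (s≤s z≤n) 2<p
    h = proj₁ ½
    2h≈1 = proj₂ ½
    algebra : ∀ r h b → (r + h + h) * b ≡ r * b + + 2 * h * b
    algebra = solve-∀

  -- Euclid's subtractive algorithm on a/b, with n bounding a + b.
  circuit : ∀ n {a b} → a ℕ.+ b ℕ.≤ n → 1 ℕ.≤ a → 1 ℕ.≤ b → a ℕ.< p → b ℕ.< p → Circuit a b
  circuit zero    () (s≤s _) 1≤b a<p b<p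
  circuit (suc n) {a} {b} a+b≤1+n 1≤a 1≤b a<p b<p with ℕ.<-cmp a b
  ... | tri≈ _ refl _ = edgeCircuit 1≤a
  ... | tri< a<b _ _ = subst (Circuit a) a+[b∸a]≡b
          (seriesCircuit 1≤a (subst (ℕ._< p) (sym a+[b∸a]≡b) b<p)
            (circuit n (subst (ℕ._≤ n) (sym a+[b∸a]≡b) b≤n) 1≤a (ℕ.m<n⇒0<n∸m a<b)
                     a<p (ℕ.≤-<-trans (ℕ.m∸n≤m b a) b<p)))
    where
    a+[b∸a]≡b = ℕ.m+[n∸m]≡n (ℕ.<⇒≤ a<b)
    b≤n = ℕ.≤-pred (ℕ.≤-trans (ℕ.+-monoˡ-≤ b 1≤a) a+b≤1+n)
  ... | tri> _ _ b<a = subst (λ x → Circuit x b) [a∸b]+b≡a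
          (parallelCircuit 1≤b (ℕ.≤-<-trans (ℕ.≤-trans (s≤s 1≤b) b<a) a<p)
            (circuit n (subst (ℕ._≤ n) (sym [a∸b]+b≡a) a≤n) (ℕ.m<n⇒0<n∸m b<a) 1≤b
                     (ℕ.≤-<-trans (ℕ.m∸n≤m a b) a<p) b<p))
    where
    [a∸b]+b≡a = ℕ.m∸n+n≡m (ℕ.<⇒≤ b<a)
    a≤n = ℕ.≤-pred (ℕ.≤-trans (subst (ℕ._≤ a ℕ.+ b) (ℕ.+-comm a 1) (ℕ.+-monoʳ-≤ a 1≤b)) a+b≤1+n)

  resistance : ∀ {r w j t} i → 0 ℕ.< j → j ℕ.< p → r * + t ≈ + j → + j * w ≡ + p * i + + t → r * w ≈ + 1
  resistance {r} {w} {j} {t} i 0<j j<p rt≈j jw≡pi+t = begin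
    r * w
      ≡⟨ ℤ.*-identityʳ (r * w) ⟨
    r * w * + 1
      ≈⟨ *-cong (≈-refl {r * w}) (≈-sym jv≈1) ⟩
    r * w * (+ j * v)
      ≡⟨ algebra r w (+ j) v ⟩
    r * (+ j * w) * v
      ≡⟨ cong (λ x → r * x * v) jw≡pi+t ⟩
    r * (+ p * i + + t) * v
      ≈⟨ *-cong (*-cong (≈-refl {r}) (+-cong (multiple≈0 i) (≈-refl {+ t}))) (≈-refl {v}) ⟩
    r * (+ 0 + + t) * v
      ≡⟨ cong (λ x → r * x * v) (ℤ.+-identityˡ (+ t)) ⟩
    r * + t * v
      ≈⟨ *-cong rt≈j (≈-refl {v}) ⟩
    + j * v
      ≈⟨ jv≈1 ⟩
    + 1 ∎
    where
    open SetoidReasoning ≈-setoid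
    v = proj₁ (inverse p-prime 0<j j<p)
    jv≈1 = proj₂ (inverse p-prime 0<j j<p)
    algebra : ∀ r w j v → r * w * (j * v) ≡ r * (j * w) * v
    algebra = solve-∀

  conductance≢0 : ∀ {r j t} → j ℕ.< p → 0 ℕ.< j → r * + t ≈ + j → ¬ (r ≡ + 0 [mod p ])
  conductance≢0 {r} {j} {t} j<p 0<j rt≈j r≡0 =
    ℕ.<⇒≱ j<p (ℕ.∣⇒≤ {{ℕ.>-nonZero 0<j}} (subst (p ℕ.∣_) (ℕ.+-identityʳ j) (≈⇒≡[mod] j≈0)))
    where
    open SetoidReasoning ≈-setoid
    j≈0 : + j ≈ + 0
    j≈0 = begin
      + j        ≈⟨ ≈-sym rt≈j ⟩
      r * + t    ≈⟨ *-cong (mk≈ {r} {+ 0} r≡0) (≈-refl {+ t}) ⟩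
      + 0 * + t  ≡⟨ ℤ.*-zeroˡ (+ t) ⟩
      + 0        ∎

ceiling-division : ∀ x j .{{_ : NonZero j}} →
                   Σ ℤ λ w → Σ ℕ λ t → 1 ℕ.≤ t × t ℕ.≤ j × + j * w ≡ x + + t
ceiling-division x j = d + + 1 , j ∸ ρ , ℕ.m<n⇒0<n∸m ρ<j , ℕ.m∸n≤m j ρ , (begin
  + j * (d + + 1)              ≡⟨ algebra (+ j) d ⟩
  d * + j + + j                ≡⟨ cong (λ n → d * + j + + n) (sym (ℕ.m+[n∸m]≡n (ℕ.<⇒≤ ρ<j))) ⟩
  d * + j + + (ρ ℕ.+ (j ∸ ρ))  ≡⟨ cong (_+_ (d * + j)) (ℤ.pos-+ ρ (j ∸ ρ)) ⟩
  d * + j + (+ ρ + + (j ∸ ρ))  ≡⟨ algebra′ (d * + j) (+ ρ) (+ (j ∸ ρ)) ⟩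
  (+ ρ + d * + j) + + (j ∸ ρ)  ≡⟨ cong (_+ + (j ∸ ρ)) (sym (ℤ.a≡a%ℕn+[a/ℕn]*n x j)) ⟩
  x + + (j ∸ ρ)                ∎)
  where
  open ≡-Reasoning
  ρ = x ℤ.%ℕ j
  d = x ℤ./ℕ j
  ρ<j = ℤ.n%ℕd<d x j
  algebra : ∀ j d → j * (d + + 1) ≡ d * j + j
  algebra = solve-∀
  algebra′ : ∀ a b c → a + (b + c) ≡ (b + a) + c
  algebra′ = solve-∀

corollary5p14 : ∃[ C ] ∀ (p : ℕ) → Prime p → ∀ (k : ℕ) → 1 Data.Nat.≤ k → k Data.Nat.≤ p ∸ 1
    → ∀ (j : ℕ) → 1 Data.Nat.≤ j → j Data.Nat.≤ k
    → ∀ (i : ℤ) → - (+ j) ≤ i → i ≤ + j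
    → ∃[ m ] Σ (Graph (2 Data.Nat.+ m)) λ G → ∃[ r ]
        IsUnitCircuit p G r
        × nnz p (laplacian G) Data.Nat.≤ C Data.Nat.* k
        × (∃[ w ] ResistanceCongruent p r w × (+ p * i ≤ + j * w) × (+ j * w ≤ + p * i + + j))
corollary5p14 = 20 , λ p p-prime k 1≤k k≤p∸1 j 1≤j j≤k i _ _ →
  let instance _ = prime⇒nonZero p-prime
      instance _ = ℕ.>-nonZero 1≤j
      j<p = ℕ.m≤pred[n]⇒suc[m]≤n (ℕ.≤-trans j≤k k≤p∸1)
      (w , t , 1≤t , t≤j , jw≡pi+t) = ceiling-division (+ p * i) j
      C = Construction.circuit p p-prime (j ℕ.+ t) ℕ.≤-refl 1≤j 1≤t j<p (ℕ.≤-<-trans t≤j j<p)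
      open Construction p p-prime using (resistance; conductance≢0)
      open Construction.Circuit C
      open Congruence p using (≈⇒≡[mod])
      10[j+t]≤20k = subst (10 ℕ.* (j ℕ.+ t) ℕ.≤_) (ten-twice k)
                          (ℕ.*-monoʳ-≤ 10 (ℕ.+-mono-≤ j≤k (ℕ.≤-trans t≤j j≤k)))
  in m , graph , conductance
     , (conductance≢0 {conductance} j<p 1≤j ratio , isCircuit)
     , ℕ.≤-trans (nnz-laplacian≤size p graph) (ℕ.≤-trans small 10[j+t]≤20k)
     , w , ≈⇒≡[mod] (resistance {conductance} i 1≤j j<p ratio jw≡pi+t)
     , subst (+ p * i ≤_) (sym jw≡pi+t) (ℤ.i≤i+j (+ p * i) (+ t))
     , subst (_≤ + p * i + + j) (sym jw≡pi+t) (ℤ.+-monoʳ-≤ (+ p * i) (+≤+ t≤j))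
  where
  ten-twice : ∀ k → 10 ℕ.* (k ℕ.+ k) ≡ 20 ℕ.* k
  ten-twice = ℕ-Solver.solve-∀
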